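{- For all $n\ge1$ and all $k$, $R_{k,2n+1}=P_{0,k,2n+1}+P_{1,k,2n+1}$; equivalently $R_{2n+1}(x)=P_{2n+1}(x,1)$.
   Context: $\mathcal{S}_m$ denotes the set of permutations $\sigma=\sigma_1\cdots\sigma_m$ of $\{1,\dots,m\}$. $\overleftarrow{des}_E(\sigma)$ is the number of indices $i$ with $\sigma_i>\sigma_{i+1}$ and $\sigma_i$ even; $\overrightarrow{des}_E(\sigma)$ is the number of indices $i$ with $\sigma_i>\sigma_{i+1}$ and $\sigma_{i+1}$ even. $R_m(x)=\sum_{\sigma\in\mathcal{S}_m}x^{\overleftarrow{des}_E(\sigma)}=\sum_k R_{k,m}x^k$ and $P_m(x,z)=\sum_{\sigma\in\mathcal{S}_m}x^{\overrightarrow{des}_E(\sigma)}z^{\chi(\sigma_1\text{ even})}=\sum_{j\in\{0,1\}}\sum_k P_{j,k,m}z^jx^k$, where $\chi(\sigma_1\text{ even})$ is $1$ if $\sigma_1$ is even and $0$ otherwise. -}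

module Defs where

open import Data.Nat using (ℕ; zero; suc; _+_; _<ᵇ_; _≡ᵇ_)
open import Data.Nat.Properties using (_≟_)
open import Data.Bool using (Bool; true; false; if_then_else_; _∧_; not)
open import Data.List using (List; []; _∷_; map; concatMap; filter; length; upTo)
open import Data.List.Relation.Unary.Unique.DecPropositional _≟_ using (Unique; unique?)

even? : ℕ → Bool
even? zero          = true
even? (suc zero)    = false
even? (suc (suc n)) = even? n

words : ℕ → ℕ → List (List ℕ)
words zero    _ = [] ∷ []
words (suc l) a = concatMap (λ i → map (suc i ∷_) (words l a)) (upTo a)

-- S_m : the permutations σ = σ₁⋯σ_m of {1,…,m}, i.e. the words of length m
-- over {1,…,m} with pairwise distinct letters.
S : ℕ → List (List ℕ)
S m = filter unique? (words m m)

desEˡ : List ℕ → ℕ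
desEˡ (a ∷ b ∷ xs) = (if (b <ᵇ a) ∧ even? a then 1 else 0) + desEˡ (b ∷ xs)
desEˡ _            = 0

desEʳ : List ℕ → ℕ
desEʳ (a ∷ b ∷ xs) = (if (b <ᵇ a) ∧ even? b then 1 else 0) + desEʳ (b ∷ xs)
desEʳ _            = 0

firstEven : List ℕ → ℕ
firstEven (a ∷ _) = if even? a then 1 else 0
firstEven []      = 0

R : ℕ → ℕ → ℕ
R k m = length (filter (λ σ → desEˡ σ ≟ k) (S m))

P : ℕ → ℕ → ℕ → ℕ
P j k m = length (filter (λ σ → firstEven σ ≟ j) (filter (λ σ → desEʳ σ ≟ k) (S m)))

-- For odd m the reverse-complement σ ↦ (m+1−σ_m)⋯(m+1−σ_1) is an involution of S_m.
-- Complementing with respect to the even number m+1 preserves parity and reverses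
-- comparisons, and reversing swaps the two letters of each adjacent pair; so the left
-- even descents of the image are exactly the right even descents of σ. Hence desEˡ and
-- desEʳ are equidistributed on S_m, and summing P_{j,k,m} over j ∈ {0,1} just forgets
-- the statistic χ(σ₁ even).
module Submission where

open import Defs
open import Data.Nat using (ℕ; zero; suc; _+_; _*_; _∸_; _≤_; _<_; _<ᵇ_; z≤n; s≤s)
open import Data.Nat.Properties
open import Data.Bool using (true; false; if_then_else_; _∧_)
open import Data.Product using (_×_; _,_; proj₁; proj₂; ∃)
open import Data.List using (List; []; _∷_; map; filter; length; upTo; reverse; _∷ʳ_)
open import Data.List.Properties
  using (length-map; reverse-map; unfold-reverse; reverse-involutive; length-reverse;
         filter-accept; filter-reject; ∷-injectiveˡ; ∷-injectiveʳ)
open import Data.List.Relation.Unary.All as All using (All; []; _∷_)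
import Data.List.Relation.Unary.All.Properties as All
open import Data.List.Relation.Unary.Any using (here; there)
open import Data.List.Relation.Unary.AllPairs as AllPairs using ([]; _∷_)
import Data.List.Relation.Unary.AllPairs.Properties as AllPairs
open import Data.List.Membership.Propositional using (_∈_)
open import Data.List.Membership.Propositional.Properties
open import Data.List.Membership.Propositional.Properties.WithK using (unique∧set⇒bag)
open import Data.List.Relation.Unary.Unique.Propositional using (Unique)
import Data.List.Relation.Unary.Unique.Propositional.Properties as Unique
open import Data.List.Relation.Binary.BagAndSetEquality using (∼bag⇒↭)
open import Data.List.Relation.Binary.Permutation.Propositional using (_↭_; ↭-sym; ↭⇒↭ₛ)
open import Data.List.Relation.Binary.Permutation.Propositional.Properties
  using (filter-↭; ↭-length; ↭-reverse; ∈-resp-↭)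
import Data.List.Relation.Binary.Permutation.Setoid.Properties as Permutationₛ
open import Data.List.Relation.Unary.Unique.DecPropositional _≟_ using (unique?)
open import Relation.Binary.PropositionalEquality
open import Relation.Nullary using (yes; no; ¬_)
open import Relation.Nullary.Reflects using (det; fromEquivalence)
open import Function using (_∘_; flip; _⇔_; mk⇔; Equivalence)
open import Relation.Unary using (Pred; Decidable)
open import Level using (0ℓ)

module _ {A : Set} where

  Unique-map⁺-injectiveOn : {B : Set} {f : A → B} {xs : List A} →
                (∀ {x y} → x ∈ xs → y ∈ xs → f x ≡ f y → x ≡ y) →
                Unique xs → Unique (map f xs)
  Unique-map⁺-injectiveOn inj [] = []
  Unique-map⁺-injectiveOn inj (x∉xs ∷ u) =
    All.map⁺ (All.tabulate λ y∈ fx≡fy → All.lookup x∉xs y∈ (inj (here refl) (there y∈) fx≡fy))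
    ∷ Unique-map⁺-injectiveOn (λ x∈ y∈ → inj (there x∈) (there y∈)) u

  map-involution-↭ : {f : A → A} {xs : List A} → Unique xs →
                     (∀ {x} → x ∈ xs → f x ∈ xs) → (∀ {x} → x ∈ xs → f (f x) ≡ x) →
                     map f xs ↭ xs
  map-involution-↭ {f} {xs} u closed invol =
    ∼bag⇒↭ (unique∧set⇒bag (Unique-map⁺-injectiveOn injective u) u (mk⇔ into onto))
    where
    injective : ∀ {x y} → x ∈ xs → y ∈ xs → f x ≡ f y → x ≡ y
    injective x∈ y∈ e = trans (sym (invol x∈)) (trans (cong f e) (invol y∈))
    into : ∀ {v} → v ∈ map f xs → v ∈ xs
    into v∈ with ∈-map⁻ f v∈
    ... | x , x∈ , refl = closed x∈
    onto : ∀ {v} → v ∈ xs → v ∈ map f xs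
    onto v∈ = subst (_∈ map f xs) (invol v∈) (∈-map⁺ f (closed v∈))

  filter-cong-All : {P Q : Pred A 0ℓ} (P? : Decidable P) (Q? : Decidable Q) {xs : List A} →
                    All (λ x → P x ⇔ Q x) xs → filter P? xs ≡ filter Q? xs
  filter-cong-All P? Q? [] = refl
  filter-cong-All P? Q? {x ∷ xs} (P⇔Q ∷ eqs) with P? x
  ... | yes p = trans (cong (x ∷_) (filter-cong-All P? Q? eqs))
                      (sym (filter-accept Q? (Equivalence.to P⇔Q p)))
  ... | no ¬p = trans (filter-cong-All P? Q? eqs)
                      (sym (filter-reject Q? (¬p ∘ Equivalence.from P⇔Q)))

filter-map : {A B : Set} {P : Pred B 0ℓ} (P? : Decidable P) (f : A → B) (xs : List A) →
             filter P? (map f xs) ≡ map f (filter (P? ∘ f) xs)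
filter-map P? f [] = refl
filter-map P? f (x ∷ xs) with P? (f x)
... | yes _ = cong (f x ∷_) (filter-map P? f xs)
... | no _  = filter-map P? f xs

length-filter-firstEven : (xs : List (List ℕ)) →
  length (filter (λ σ → firstEven σ ≟ 0) xs) + length (filter (λ σ → firstEven σ ≟ 1) xs)
    ≡ length xs
length-filter-firstEven [] = refl
length-filter-firstEven ([] ∷ xs) = cong suc (length-filter-firstEven xs)
length-filter-firstEven ((a ∷ _) ∷ xs) with even? a
... | true  = trans (+-suc _ _) (cong suc (length-filter-firstEven xs))
... | false = cong suc (length-filter-firstEven xs)

even?-suc-true : ∀ n → even? (suc n) ≡ true → even? n ≡ false
even?-suc-true (suc zero)    _ = refl
even?-suc-true (suc (suc n)) e = even?-suc-true n e

even?-+ : ∀ x y → even? (x + y) ≡ true → even? x ≡ even? y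
even?-+ zero          y e = sym e
even?-+ (suc zero)    y e = sym (even?-suc-true y e)
even?-+ (suc (suc x)) y e = even?-+ x y e

even?-2* : ∀ n → even? (2 * n) ≡ true
even?-2* zero    = refl
even?-2* (suc n) = trans (cong even? (*-suc 2 n)) (even?-2* n)

even?-suc-odd : ∀ n → even? (suc (2 * n + 1)) ≡ true
even?-suc-odd n = trans (cong (even? ∘ suc) (+-comm (2 * n) 1)) (even?-2* n)

sumAdjacent : (ℕ → ℕ → ℕ) → List ℕ → ℕ
sumAdjacent g (a ∷ b ∷ xs) = g a b + sumAdjacent g (b ∷ xs)
sumAdjacent g _            = 0

leftEvenDescent rightEvenDescent : ℕ → ℕ → ℕ
leftEvenDescent  a b = if (b <ᵇ a) ∧ even? a then 1 else 0
rightEvenDescent a b = if (b <ᵇ a) ∧ even? b then 1 else 0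

desEˡ-sumAdjacent : ∀ σ → desEˡ σ ≡ sumAdjacent leftEvenDescent σ
desEˡ-sumAdjacent []           = refl
desEˡ-sumAdjacent (a ∷ [])     = refl
desEˡ-sumAdjacent (a ∷ b ∷ xs) = cong (leftEvenDescent a b +_) (desEˡ-sumAdjacent (b ∷ xs))

desEʳ-sumAdjacent : ∀ σ → desEʳ σ ≡ sumAdjacent rightEvenDescent σ
desEʳ-sumAdjacent []           = refl
desEʳ-sumAdjacent (a ∷ [])     = refl
desEʳ-sumAdjacent (a ∷ b ∷ xs) = cong (rightEvenDescent a b +_) (desEʳ-sumAdjacent (b ∷ xs))

sumAdjacent-∷ʳ : ∀ g xs y z → sumAdjacent g (xs ∷ʳ y ∷ʳ z) ≡ sumAdjacent g (xs ∷ʳ y) + g y z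
sumAdjacent-∷ʳ g []             y z = +-comm (g y z) 0
sumAdjacent-∷ʳ g (x ∷ [])       y z =
  trans (cong (g x y +_) (sumAdjacent-∷ʳ g [] y z)) (sym (+-assoc (g x y) 0 (g y z)))
sumAdjacent-∷ʳ g (x ∷ x′ ∷ xs) y z =
  trans (cong (g x x′ +_) (sumAdjacent-∷ʳ g (x′ ∷ xs) y z)) (sym (+-assoc (g x x′) _ _))

sumAdjacent-reverse : ∀ g σ → sumAdjacent g (reverse σ) ≡ sumAdjacent (flip g) σ
sumAdjacent-reverse g []          = refl
sumAdjacent-reverse g (a ∷ [])    = refl
sumAdjacent-reverse g (a ∷ b ∷ σ) = begin
  sumAdjacent g (reverse (a ∷ b ∷ σ))
    ≡⟨ cong (sumAdjacent g) (trans (unfold-reverse a (b ∷ σ)) (cong (_∷ʳ a) (unfold-reverse b σ))) ⟩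
  sumAdjacent g (reverse σ ∷ʳ b ∷ʳ a)
    ≡⟨ sumAdjacent-∷ʳ g (reverse σ) b a ⟩
  sumAdjacent g (reverse σ ∷ʳ b) + g b a
    ≡⟨ cong (λ τ → sumAdjacent g τ + g b a) (unfold-reverse b σ) ⟨
  sumAdjacent g (reverse (b ∷ σ)) + g b a
    ≡⟨ cong (_+ g b a) (sumAdjacent-reverse g (b ∷ σ)) ⟩
  sumAdjacent (flip g) (b ∷ σ) + g b a
    ≡⟨ +-comm _ (g b a) ⟩
  sumAdjacent (flip g) (a ∷ b ∷ σ)
    ∎
  where open ≡-Reasoning

sumAdjacent-map : ∀ g f σ → sumAdjacent g (map f σ) ≡ sumAdjacent (λ a b → g (f a) (f b)) σ
sumAdjacent-map g f []          = refl
sumAdjacent-map g f (a ∷ [])    = refl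
sumAdjacent-map g f (a ∷ b ∷ σ) = cong (g (f a) (f b) +_) (sumAdjacent-map g f (b ∷ σ))

sumAdjacent-cong-All : ∀ (P : ℕ → Set) g h → (∀ {a b} → P a → P b → g a b ≡ h a b) →
                       ∀ σ → All P σ → sumAdjacent g σ ≡ sumAdjacent h σ
sumAdjacent-cong-All P g h e []          _                = refl
sumAdjacent-cong-All P g h e (a ∷ [])    _                = refl
sumAdjacent-cong-All P g h e (a ∷ b ∷ σ) (pa ∷ pb ∷ pσ) =
  cong₂ _+_ (e pa pb) (sumAdjacent-cong-All P g h e (b ∷ σ) (pb ∷ pσ))

InRange : ℕ → ℕ → Set
InRange m v = 0 < v × v ≤ m

∈-words⁻ : ∀ l a {σ} → σ ∈ words l a → length σ ≡ l × All (InRange a) σ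
∈-words⁻ zero    a (here refl) = refl , []
∈-words⁻ (suc l) a σ∈ with ∈-concat⁻′ (map (λ i → map (suc i ∷_) (words l a)) (upTo a)) σ∈
... | τs , σ∈τs , τs∈ with ∈-map⁻ (λ i → map (suc i ∷_) (words l a)) τs∈
... | i , i∈ , refl with ∈-map⁻ (suc i ∷_) σ∈τs
... | τ , τ∈ , refl with ∈-words⁻ l a τ∈
... | len , inRange = cong suc len , (s≤s z≤n , ∈-upTo⁻ i∈) ∷ inRange

∈-words⁺ : ∀ l a {σ} → length σ ≡ l → All (InRange a) σ → σ ∈ words l a
∈-words⁺ zero    a {[]}        refl []                          = here refl
∈-words⁺ (suc l) a {suc i ∷ τ} refl ((s≤s z≤n , i<a) ∷ inRange) =
  ∈-concat⁺′ (∈-map⁺ (suc i ∷_) (∈-words⁺ l a refl inRange))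
             (∈-map⁺ (λ i → map (suc i ∷_) (words l a)) (∈-upTo⁺ i<a))

Unique-words : ∀ l a → Unique (words l a)
Unique-words zero    a = [] ∷ []
Unique-words (suc l) a =
  Unique.concat⁺ (All.map⁺ (All.tabulate (λ _ → Unique.map⁺ ∷-injectiveʳ (Unique-words l a))))
                 (AllPairs.map⁺ (AllPairs.map disjoint (Unique.upTo⁺ a)))
  where
  disjoint : ∀ {i j} → ¬ i ≡ j → ∀ {σ} →
             ¬ (σ ∈ map (suc i ∷_) (words l a) × σ ∈ map (suc j ∷_) (words l a))
  disjoint i≢j (σ∈ᵢ , σ∈ⱼ) with ∈-map⁻ _ σ∈ᵢ | ∈-map⁻ _ σ∈ⱼ
  ... | _ , _ , refl | _ , _ , e = i≢j (suc-injective (∷-injectiveˡ e))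

IsPermutation : ℕ → List ℕ → Set
IsPermutation m σ = length σ ≡ m × All (InRange m) σ × Unique σ

∈-S⁻ : ∀ m {σ} → σ ∈ S m → IsPermutation m σ
∈-S⁻ m σ∈ with ∈-filter⁻ unique? σ∈
... | σ∈words , unique with ∈-words⁻ m m σ∈words
... | len , inRange = len , inRange , unique

∈-S⁺ : ∀ m {σ} → IsPermutation m σ → σ ∈ S m
∈-S⁺ m (len , inRange , unique) = ∈-filter⁺ unique? (∈-words⁺ m m len inRange) unique

Unique-S : ∀ m → Unique (S m)
Unique-S m = Unique.filter⁺ unique? (Unique-words m m)

module ReverseComplement (m : ℕ) (m+1-even : even? (suc m) ≡ true) where

  complement : ℕ → ℕ
  complement v = suc m ∸ v

  private
    ≤m+1 : ∀ {v} → InRange m v → v ≤ suc m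
    ≤m+1 (_ , v≤m) = m≤n⇒m≤1+n v≤m

  complement-InRange : ∀ {v} → InRange m v → InRange m (complement v)
  complement-InRange {suc i} (_ , i<m) = m<n⇒0<n∸m i<m , m∸n≤m m i

  complement-involutive : ∀ {v} → InRange m v → complement (complement v) ≡ v
  complement-involutive v∈ = m∸[m∸n]≡n (≤m+1 v∈)

  complement-injective : ∀ {x y} → InRange m x → InRange m y →
                         complement x ≡ complement y → x ≡ y
  complement-injective x∈ y∈ e =
    trans (sym (complement-involutive x∈)) (trans (cong complement e) (complement-involutive y∈))

  even?-complement : ∀ {v} → InRange m v → even? (complement v) ≡ even? v
  even?-complement {v} v∈ =
    even?-+ (complement v) v (trans (cong even? (m∸n+n≡m (≤m+1 v∈))) m+1-even)

  complement-<ᵇ : ∀ {a b} → InRange m a → InRange m b → (complement a <ᵇ complement b) ≡ (b <ᵇ a)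
  complement-<ᵇ {a} {b} a∈ b∈ = det (<ᵇ-reflects-< (complement a) (complement b))
    (fromEquivalence (λ b<a → ∸-monoʳ-< (<ᵇ⇒< b a b<a) (≤m+1 a∈))
                     (λ ca<cb → <⇒<ᵇ (∸-cancelʳ-< {a} {b} {suc m} ca<cb)))

  leftEvenDescent-complement : ∀ {a b} → InRange m a → InRange m b →
    leftEvenDescent (complement b) (complement a) ≡ rightEvenDescent a b
  leftEvenDescent-complement a∈ b∈ =
    cong₂ (λ x y → if x ∧ y then 1 else 0) (complement-<ᵇ a∈ b∈) (even?-complement b∈)

  reverseComplement : List ℕ → List ℕ
  reverseComplement σ = reverse (map complement σ)

  desEˡ-reverseComplement : ∀ σ → All (InRange m) σ → desEˡ (reverseComplement σ) ≡ desEʳ σ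
  desEˡ-reverseComplement σ σ∈ = begin
    desEˡ (reverse (map complement σ))
      ≡⟨ desEˡ-sumAdjacent (reverse (map complement σ)) ⟩
    sumAdjacent leftEvenDescent (reverse (map complement σ))
      ≡⟨ sumAdjacent-reverse leftEvenDescent (map complement σ) ⟩
    sumAdjacent (flip leftEvenDescent) (map complement σ)
      ≡⟨ sumAdjacent-map (flip leftEvenDescent) complement σ ⟩
    sumAdjacent (λ a b → leftEvenDescent (complement b) (complement a)) σ
      ≡⟨ sumAdjacent-cong-All (InRange m) _ _ leftEvenDescent-complement σ σ∈ ⟩
    sumAdjacent rightEvenDescent σ
      ≡⟨ desEʳ-sumAdjacent σ ⟨
    desEʳ σ
      ∎
    where open ≡-Reasoning

  reverseComplement-involutive : ∀ {σ} → All (InRange m) σ →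
                                 reverseComplement (reverseComplement σ) ≡ σ
  reverseComplement-involutive {σ} σ∈ = begin
    reverse (map complement (reverse (map complement σ)))
      ≡⟨ cong reverse (reverse-map complement (map complement σ)) ⟩
    reverse (reverse (map complement (map complement σ)))
      ≡⟨ reverse-involutive _ ⟩
    map complement (map complement σ)
      ≡⟨ map-complement-involutive σ∈ ⟩
    σ
      ∎
    where
    open ≡-Reasoning
    map-complement-involutive : ∀ {τ} → All (InRange m) τ → map complement (map complement τ) ≡ τ
    map-complement-involutive []         = refl
    map-complement-involutive (v∈ ∷ τ∈) =
      cong₂ _∷_ (complement-involutive v∈) (map-complement-involutive τ∈)

  reverseComplement-IsPermutation : ∀ {σ} → IsPermutation m σ →
                                    IsPermutation m (reverseComplement σ)
  reverseComplement-IsPermutation {σ} (len , σ∈ , unique) =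
    trans (length-reverse (map complement σ)) (trans (length-map complement σ) len) ,
    All.tabulate (λ v∈ → complement-InRange-∈ (∈-map⁻ complement (∈-resp-↭ reverse↭ v∈))) ,
    Permutationₛ.Unique-resp-↭ (setoid ℕ) (↭⇒↭ₛ (↭-sym reverse↭))
      (Unique-map⁺-injectiveOn
        (λ x∈ y∈ → complement-injective (All.lookup σ∈ x∈) (All.lookup σ∈ y∈)) unique)
    where
    reverse↭ : reverse (map complement σ) ↭ map complement σ
    reverse↭ = ↭-reverse (map complement σ)
    complement-InRange-∈ : ∀ {v} → ∃ (λ x → x ∈ σ × v ≡ complement x) → InRange m v
    complement-InRange-∈ (x , x∈ , refl) = complement-InRange (All.lookup σ∈ x∈)

  map-reverseComplement-S : map reverseComplement (S m) ↭ S m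
  map-reverseComplement-S = map-involution-↭ (Unique-S m)
    (λ σ∈ → ∈-S⁺ m (reverseComplement-IsPermutation (∈-S⁻ m σ∈)))
    (λ σ∈ → reverseComplement-involutive (proj₁ (proj₂ (∈-S⁻ m σ∈))))

R≡P₀+P₁ : ∀ m → even? (suc m) ≡ true → ∀ k → R k m ≡ P 0 k m + P 1 k m
R≡P₀+P₁ m m+1-even k = begin
  length (filter (λ σ → desEˡ σ ≟ k) (S m))
    ≡⟨ ↭-length (filter-↭ (λ σ → desEˡ σ ≟ k) map-reverseComplement-S) ⟨
  length (filter (λ σ → desEˡ σ ≟ k) (map reverseComplement (S m)))
    ≡⟨ cong length (filter-map (λ σ → desEˡ σ ≟ k) reverseComplement (S m)) ⟩
  length (map reverseComplement (filter (λ σ → desEˡ (reverseComplement σ) ≟ k) (S m)))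
    ≡⟨ length-map reverseComplement (filter (λ σ → desEˡ (reverseComplement σ) ≟ k) (S m)) ⟩
  length (filter (λ σ → desEˡ (reverseComplement σ) ≟ k) (S m))
    ≡⟨ cong length (filter-cong-All _ _ (All.tabulate same-desE)) ⟩
  length (filter (λ σ → desEʳ σ ≟ k) (S m))
    ≡⟨ length-filter-firstEven (filter (λ σ → desEʳ σ ≟ k) (S m)) ⟨
  P 0 k m + P 1 k m
    ∎
  where
  open ≡-Reasoning
  open ReverseComplement m m+1-even
  same-desE : ∀ {σ} → σ ∈ S m → (desEˡ (reverseComplement σ) ≡ k) ⇔ (desEʳ σ ≡ k)
  same-desE {σ} σ∈ = mk⇔ (trans (sym e)) (trans e)
    where e = desEˡ-reverseComplement σ (proj₁ (proj₂ (∈-S⁻ m σ∈)))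

theorem4p5 : (n k : ℕ) → R k (2 * suc n + 1) ≡ P 0 k (2 * suc n + 1) + P 1 k (2 * suc n + 1)
theorem4p5 n = R≡P₀+P₁ (2 * suc n + 1) (even?-suc-odd (suc n))
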